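{- Let $\mathbb{V}$ be a vector space of dimension $n$ over the field with $2$ elements, and let $G(\mathbb{V})$ be its non-zero component graph. Then $|\mathrm{Aut}(G(\mathbb{V}))|=n!$.
   Context: The non-zero component graph $G(\mathbb{V})$ of a finite-dimensional vector space $\mathbb{V}$ with a fixed basis $\{b_1,\dots,b_n\}$ has as vertex set the non-zero vectors of $\mathbb{V}$, two distinct vertices being adjacent if and only if there is some $b_i$ having non-zero coefficient in the expansions of both vectors with respect to the basis. -}

module Defs where

open import Data.Nat using (ℕ)
open import Data.Bool using (Bool; true; false; _∨_; T)
open import Data.Fin using (Fin)
open import Data.Vec using (Vec; []; _∷_; lookup)
open import Data.Product using (Σ; ∃; _×_; _,_; proj₁)
open import Relation.Binary.PropositionalEquality using (_≡_; _≢_)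
open import Relation.Binary.Bundles using (Setoid)
open import Function.Bundles using (_⇔_)
open import Function.Definitions using (Bijective)
open import Level using (0ℓ)

-- Vectors of 𝔽₂ⁿ in coordinates w.r.t. the fixed (standard) basis b₁,…,bₙ;
-- 𝔽₂ = Bool with false = 0, true = 1.
𝔽₂^ : ℕ → Set
𝔽₂^ n = Vec Bool n

isNonzero : ∀ {n} → 𝔽₂^ n → Bool
isNonzero []       = false
isNonzero (x ∷ xs) = x ∨ isNonzero xs

Vertex : ℕ → Set
Vertex n = Σ (𝔽₂^ n) (λ v → T (isNonzero v))

Adj : ∀ {n} → Vertex n → Vertex n → Set
Adj {n} u v = proj₁ u ≢ proj₁ v
  × ∃ (λ (i : Fin n) → lookup (proj₁ u) i ≡ true × lookup (proj₁ v) i ≡ true)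

record Aut (n : ℕ) : Set where
  field
    f         : Vertex n → Vertex n
    bijective : Bijective _≡_ _≡_ f
    preserves : ∀ u v → Adj u v ⇔ Adj (f u) (f v)

AutSetoid : ℕ → Setoid 0ℓ 0ℓ
AutSetoid n = record
  { Carrier = Aut n
  ; _≈_ = λ σ τ → ∀ x → Aut.f σ x ≡ Aut.f τ x
  ; isEquivalence = record
    { refl  = λ x → Relation.Binary.PropositionalEquality.refl
    ; sym   = λ p x → Relation.Binary.PropositionalEquality.sym (p x)
    ; trans = λ p q x → Relation.Binary.PropositionalEquality.trans (p x) (q x)
    }
  }
  where import Relation.Binary.PropositionalEquality

module Submission where

-- Two distinct vertices are adjacent iff their supports meet, so an automorphism preserves the
-- relation "equal or adjacent", that is, meeting supports. Support inclusion is definable from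
-- it: supp u ⊆ supp v iff every vertex meeting u meets v (test against the basis vectors). Hence
-- an automorphism preserves inclusion both ways, maps the inclusion-minimal vertices, the basis
-- vectors, onto themselves, and acts on every vertex by the induced permutation of its support.
-- Conversely every permutation of the basis is an automorphism, so Aut(G(V)) is in bijection
-- with Sₙ.

open import Defs
open import Data.Bool using (true; false; T)
open import Data.Bool.Properties using (T-irrelevant) renaming (_≟_ to _≟ᴮ_)
open import Data.Fin using (Fin; zero; suc; combine; remQuot; punchOut; punchIn)
open import Data.Fin.Permutation
  using ( Permutation′; permutation; _⟨$⟩ʳ_; _⟨$⟩ˡ_; inverseˡ; inverseʳ; flip; id; _≈_
        ; insert; remove; insert-remove; remove-insert)
open import Data.Fin.Properties using (punchOut-cong; combine-injective; combine-remQuot)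
open import Data.Fin.Subset using (Subset; _∈_; _⊆_; ⁅_⁆; Nonempty)
open import Data.Fin.Subset.Properties using (x∈⁅x⁆; x∈⁅y⁆⇒x≡y; ⊆-antisym)
open import Data.Nat using (ℕ; zero; suc; _!)
open import Data.Product using (∃; _×_; _,_; proj₁; proj₂)
open import Data.Sum using (_⊎_; inj₁; inj₂)
import Data.Sum as Sum
open import Data.Unit using (tt)
open import Data.Vec using (_∷_; lookup; tabulate; here; there)
open import Data.Vec.Properties
  using (≡-dec; lookup∘tabulate; tabulate∘lookup; tabulate-cong; []=⇒lookup; lookup⇒[]=)
open import Function using (_∘_; _⇔_; mk⇔; Equivalence; Bijection)
import Function.Properties.Bijection as Bijection
import Function.Properties.Equivalence as Equiv
open import Level using (0ℓ)
open import Relation.Binary.Bundles using (Setoid)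
open import Relation.Binary.PropositionalEquality
open import Relation.Nullary using (yes; no)

open Equivalence using (to; from)

Permutations : ℕ → Setoid 0ℓ 0ℓ
Permutations n = record
  { Carrier       = Permutation′ n
  ; _≈_           = _≈_
  ; isEquivalence = record
    { refl  = λ _ → refl
    ; sym   = λ π≈ρ i → sym (π≈ρ i)
    ; trans = λ π≈ρ ρ≈τ i → trans (π≈ρ i) (ρ≈τ i)
    }
  }

punchOut-cong₂ : ∀ {n} {i i′ j j′ : Fin (suc n)} {i≢j : i ≢ j} {i′≢j′ : i′ ≢ j′} →
                 i ≡ i′ → j ≡ j′ → punchOut i≢j ≡ punchOut i′≢j′
punchOut-cong₂ {i = i} refl = punchOut-cong i

remove-cong : ∀ {n} (π ρ : Permutation′ (suc n)) → π ≈ ρ → remove zero π ≈ remove zero ρ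
remove-cong π ρ π≈ρ k = punchOut-cong₂ (π≈ρ zero) (π≈ρ (suc k))

insert-cong : ∀ {n} {i j : Fin (suc n)} (π ρ : Permutation′ n) →
              i ≡ j → π ≈ ρ → insert zero i π ≈ insert zero j ρ
insert-cong π ρ i≡j π≈ρ zero    = i≡j
insert-cong π ρ i≡j π≈ρ (suc k) = cong₂ punchIn i≡j (π≈ρ k)

-- Lehmer code: a permutation of Fin (suc n) is determined by its value at zero and by the
-- permutation of Fin n that it induces on the remaining points.
encode : ∀ {n} → Permutation′ n → Fin (n !)
encode {zero}  π = zero
encode {suc n} π = combine (π ⟨$⟩ʳ zero) (encode (remove zero π))

decode : ∀ {n} → Fin (n !) → Permutation′ n
decode {zero}  _ = id
decode {suc n} k =
  insert zero (proj₁ (remQuot {suc n} (n !) k)) (decode (proj₂ (remQuot {suc n} (n !) k)))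

encode-cong : ∀ {n} (π ρ : Permutation′ n) → π ≈ ρ → encode π ≡ encode ρ
encode-cong {zero}  π ρ π≈ρ = refl
encode-cong {suc n} π ρ π≈ρ =
  cong₂ combine (π≈ρ zero) (encode-cong (remove zero π) (remove zero ρ) (remove-cong π ρ π≈ρ))

encode-injective : ∀ {n} (π ρ : Permutation′ n) → encode π ≡ encode ρ → π ≈ ρ
encode-injective {zero}  π ρ _ ()
encode-injective {suc n} π ρ eq k with combine-injective _ _ _ _ eq
... | π0≡ρ0 , rest≡ = begin
  π ⟨$⟩ʳ k
    ≡⟨ insert-remove zero π k ⟨
  insert zero (π ⟨$⟩ʳ zero) (remove zero π) ⟨$⟩ʳ k
    ≡⟨ insert-cong _ _ π0≡ρ0 (encode-injective _ _ rest≡) k ⟩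
  insert zero (ρ ⟨$⟩ʳ zero) (remove zero ρ) ⟨$⟩ʳ k
    ≡⟨ insert-remove zero ρ k ⟩
  ρ ⟨$⟩ʳ k
    ∎
  where open ≡-Reasoning

encode-decode : ∀ {n} (k : Fin (n !)) → encode {n} (decode k) ≡ k
encode-decode {zero}  zero = refl
encode-decode {suc n} k = begin
  combine i (encode (remove zero (insert zero i (decode k′))))
    ≡⟨ cong (combine i) (encode-cong _ _ (remove-insert zero i (decode k′))) ⟩
  combine i (encode {n} (decode k′))
    ≡⟨ cong (combine i) (encode-decode {n} k′) ⟩
  combine i k′
    ≡⟨ combine-remQuot {suc n} (n !) k ⟩
  k
    ∎
  where
  open ≡-Reasoning
  i  = proj₁ (remQuot {suc n} (n !) k)
  k′ = proj₂ (remQuot {suc n} (n !) k)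

Permutations↔Fin! : ∀ n → Bijection (Permutations n) (setoid (Fin (n !)))
Permutations↔Fin! n = record
  { to        = encode
  ; cong      = λ {π} {ρ} → encode-cong π ρ
  ; bijective = (λ {π} {ρ} → encode-injective π ρ) , λ k → decode k , λ {π} π≈decode →
      trans (encode-cong π (decode k) π≈decode) (encode-decode {n} k)
  }

vertex-≡ : ∀ {n} {u v : Vertex n} → proj₁ u ≡ proj₁ v → u ≡ v
vertex-≡ {u = p , _} refl = cong (p ,_) (T-irrelevant _ _)

∈-ext : ∀ {n} {p q : Subset n} → (∀ i → i ∈ p ⇔ i ∈ q) → p ≡ q
∈-ext p≃q = ⊆-antisym (to (p≃q _)) (from (p≃q _))

nonzero⇒nonempty : ∀ {n} (p : Subset n) → T (isNonzero p) → Nonempty p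
nonzero⇒nonempty (true  ∷ p) _  = zero , here
nonzero⇒nonempty (false ∷ p) nz with nonzero⇒nonempty p nz
... | i , i∈p = suc i , there i∈p

nonempty⇒nonzero : ∀ {n} {p : Subset n} → Nonempty p → T (isNonzero p)
nonempty⇒nonzero                   (zero  , here)      = tt
nonempty⇒nonzero {p = true  ∷ _} (suc _ , there _)   = tt
nonempty⇒nonzero {p = false ∷ _} (suc i , there i∈p) = nonempty⇒nonzero (i , i∈p)

pick : ∀ {n} → Vertex n → Fin n
pick (p , nz) = proj₁ (nonzero⇒nonempty p nz)

pick∈ : ∀ {n} (v : Vertex n) → pick v ∈ proj₁ v
pick∈ (p , nz) = proj₂ (nonzero⇒nonempty p nz)

⁅_⁆ᵛ : ∀ {n} → Fin n → Vertex n
⁅ i ⁆ᵛ = ⁅ i ⁆ , nonempty⇒nonzero (i , x∈⁅x⁆ i)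

pick-⁅⁆ : ∀ {n} {v : Vertex n} {j} → v ≡ ⁅ j ⁆ᵛ → pick v ≡ j
pick-⁅⁆ {v = v} refl = x∈⁅y⁆⇒x≡y _ (pick∈ v)

⁅⁆⊆⇔∈ : ∀ {n} {i : Fin n} {p} → ⁅ i ⁆ ⊆ p ⇔ i ∈ p
⁅⁆⊆⇔∈ {i = i} {p} = mk⇔ (λ ⁅i⁆⊆p → ⁅i⁆⊆p (x∈⁅x⁆ i))
                          (λ i∈p {x} x∈⁅i⁆ → subst (_∈ p) (sym (x∈⁅y⁆⇒x≡y i x∈⁅i⁆)) i∈p)

_⊆ᵛ_ : ∀ {n} → Vertex n → Vertex n → Set
u ⊆ᵛ v = proj₁ u ⊆ proj₁ v

⊆⁅⁆⇒≡⁅⁆ : ∀ {n} {u : Vertex n} {i} → u ⊆ᵛ ⁅ i ⁆ᵛ → u ≡ ⁅ i ⁆ᵛ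
⊆⁅⁆⇒≡⁅⁆ {u = u} {i} u⊆⁅i⁆ = vertex-≡ (⊆-antisym u⊆⁅i⁆ (from ⁅⁆⊆⇔∈ i∈u))
  where
  i∈u : i ∈ proj₁ u
  i∈u = subst (_∈ proj₁ u) (x∈⁅y⁆⇒x≡y i (u⊆⁅i⁆ (pick∈ u))) (pick∈ u)

Overlap : ∀ {n} → Vertex n → Vertex n → Set
Overlap u v = ∃ λ i → i ∈ proj₁ u × i ∈ proj₁ v

Adj⇔≢×Overlap : ∀ {n} (u v : Vertex n) → Adj u v ⇔ (proj₁ u ≢ proj₁ v × Overlap u v)
Adj⇔≢×Overlap u v = mk⇔
  (λ (u≢v , i , uᵢ , vᵢ) → u≢v , i , lookup⇒[]= i _ uᵢ , lookup⇒[]= i _ vᵢ)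
  (λ (u≢v , i , i∈u , i∈v) → u≢v , i , []=⇒lookup i∈u , []=⇒lookup i∈v)

Overlap⇔≡⊎Adj : ∀ {n} (u v : Vertex n) → Overlap u v ⇔ (u ≡ v ⊎ Adj u v)
Overlap⇔≡⊎Adj u v = mk⇔ ≡⊎Adj ≡⊎Adj⇒Overlap
  where
  ≡⊎Adj : Overlap u v → u ≡ v ⊎ Adj u v
  ≡⊎Adj u∩v with ≡-dec _≟ᴮ_ (proj₁ u) (proj₁ v)
  ... | yes u≡v = inj₁ (vertex-≡ u≡v)
  ... | no  u≢v = inj₂ (from (Adj⇔≢×Overlap u v) (u≢v , u∩v))

  ≡⊎Adj⇒Overlap : u ≡ v ⊎ Adj u v → Overlap u v
  ≡⊎Adj⇒Overlap (inj₁ refl) = pick u , pick∈ u , pick∈ u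
  ≡⊎Adj⇒Overlap (inj₂ u~v)  = proj₂ (to (Adj⇔≢×Overlap u v) u~v)

⊆ᵛ⇔Overlap-mono : ∀ {n} (u v : Vertex n) → u ⊆ᵛ v ⇔ (∀ w → Overlap u w → Overlap v w)
⊆ᵛ⇔Overlap-mono u v = mk⇔
  (λ u⊆v w (i , i∈u , i∈w) → i , u⊆v i∈u , i∈w)
  (λ mono {i} i∈u → case-⁅i⁆ (mono ⁅ i ⁆ᵛ (i , i∈u , x∈⁅x⁆ i)))
  where
  case-⁅i⁆ : ∀ {i} → Overlap v ⁅ i ⁆ᵛ → i ∈ proj₁ v
  case-⁅i⁆ {i} (k , k∈v , k∈⁅i⁆) = subst (_∈ proj₁ v) (x∈⁅y⁆⇒x≡y i k∈⁅i⁆) k∈v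

⁅⁆-image : ∀ {n} (f g : Vertex n → Vertex n) →
           (∀ y → f (g y) ≡ y) → (∀ {u v} → f u ⊆ᵛ f v → u ⊆ᵛ v) →
           ∀ {i j} → j ∈ proj₁ (f ⁅ i ⁆ᵛ) → f ⁅ i ⁆ᵛ ≡ ⁅ j ⁆ᵛ
⁅⁆-image f g f∘g ⊆-reflected {i} {j} j∈f⁅i⁆ = begin
  f ⁅ i ⁆ᵛ      ≡⟨ cong f g⁅j⁆≡⁅i⁆ ⟨
  f (g ⁅ j ⁆ᵛ)  ≡⟨ f∘g ⁅ j ⁆ᵛ ⟩
  ⁅ j ⁆ᵛ        ∎
  where
  open ≡-Reasoning
  g⁅j⁆≡⁅i⁆ : g ⁅ j ⁆ᵛ ≡ ⁅ i ⁆ᵛ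
  g⁅j⁆≡⁅i⁆ = ⊆⁅⁆⇒≡⁅⁆ (⊆-reflected (subst (_⊆ᵛ f ⁅ i ⁆ᵛ) (sym (f∘g ⁅ j ⁆ᵛ)) (from ⁅⁆⊆⇔∈ j∈f⁅i⁆)))

permute : ∀ {n} → Permutation′ n → Subset n → Subset n
permute π p = tabulate (λ j → lookup p (π ⟨$⟩ˡ j))

∈-permute : ∀ {n} (π : Permutation′ n) {p j} → j ∈ permute π p ⇔ π ⟨$⟩ˡ j ∈ p
∈-permute π {p} {j} = mk⇔
  (λ j∈πp → lookup⇒[]= _ p (trans (sym (lookup∘tabulate _ j)) ([]=⇒lookup j∈πp)))
  (λ πj∈p → lookup⇒[]= j _ (trans (lookup∘tabulate _ j) ([]=⇒lookup πj∈p)))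

∈-permute⁺ : ∀ {n} (π : Permutation′ n) {p i} → i ∈ p → π ⟨$⟩ʳ i ∈ permute π p
∈-permute⁺ π {p} i∈p = from (∈-permute π) (subst (_∈ p) (sym (inverseˡ π)) i∈p)

∈-permute-⁅⁆ : ∀ {n} (π : Permutation′ n) {i j} → j ∈ permute π ⁅ i ⁆ → j ≡ π ⟨$⟩ʳ i
∈-permute-⁅⁆ π {i} j∈π⁅i⁆ =
  trans (sym (inverseʳ π)) (cong (π ⟨$⟩ʳ_) (x∈⁅y⁆⇒x≡y i (to (∈-permute π) j∈π⁅i⁆)))

permute-flip : ∀ {n} (π : Permutation′ n) p → permute (flip π) (permute π p) ≡ p
permute-flip π p = begin
  tabulate (λ j → lookup (permute π p) (π ⟨$⟩ʳ j))
    ≡⟨ tabulate-cong (λ j → trans (lookup∘tabulate _ (π ⟨$⟩ʳ j)) (cong (lookup p) (inverseˡ π))) ⟩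
  tabulate (lookup p)
    ≡⟨ tabulate∘lookup p ⟩
  p
    ∎
  where open ≡-Reasoning

permute-cong : ∀ {n} (π ρ : Permutation′ n) → π ≈ ρ → ∀ p → permute π p ≡ permute ρ p
permute-cong π ρ π≈ρ p = tabulate-cong λ j → cong (lookup p) (begin
  π ⟨$⟩ˡ j                        ≡⟨ inverseˡ ρ ⟨
  ρ ⟨$⟩ˡ (ρ ⟨$⟩ʳ (π ⟨$⟩ˡ j))      ≡⟨ cong (ρ ⟨$⟩ˡ_) (π≈ρ _) ⟨
  ρ ⟨$⟩ˡ (π ⟨$⟩ʳ (π ⟨$⟩ˡ j))      ≡⟨ cong (ρ ⟨$⟩ˡ_) (inverseʳ π) ⟩
  ρ ⟨$⟩ˡ j                        ∎)
  where open ≡-Reasoning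

permuteᵛ : ∀ {n} → Permutation′ n → Vertex n → Vertex n
permuteᵛ π v = permute π (proj₁ v) , nonempty⇒nonzero (π ⟨$⟩ʳ pick v , ∈-permute⁺ π (pick∈ v))

permuteᵛ-flip : ∀ {n} (π : Permutation′ n) v → permuteᵛ (flip π) (permuteᵛ π v) ≡ v
permuteᵛ-flip π v = vertex-≡ (permute-flip π (proj₁ v))

permuteᵛ-injective : ∀ {n} (π : Permutation′ n) {u v} → permuteᵛ π u ≡ permuteᵛ π v → u ≡ v
permuteᵛ-injective π {u} {v} πu≡πv =
  trans (sym (permuteᵛ-flip π u)) (trans (cong (permuteᵛ (flip π)) πu≡πv) (permuteᵛ-flip π v))

Overlap-permuteᵛ : ∀ {n} (π : Permutation′ n) {u v} →
                   Overlap u v ⇔ Overlap (permuteᵛ π u) (permuteᵛ π v)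
Overlap-permuteᵛ π = mk⇔
  (λ (i , i∈u , i∈v) → π ⟨$⟩ʳ i , ∈-permute⁺ π i∈u , ∈-permute⁺ π i∈v)
  (λ (j , j∈πu , j∈πv) → π ⟨$⟩ˡ j , to (∈-permute π) j∈πu , to (∈-permute π) j∈πv)

Adj-permuteᵛ : ∀ {n} (π : Permutation′ n) u v → Adj u v ⇔ Adj (permuteᵛ π u) (permuteᵛ π v)
Adj-permuteᵛ π u v = mk⇔
  (λ u~v → let (u≢v , u∩v) = to (Adj⇔≢×Overlap u v) u~v in
    from (Adj⇔≢×Overlap (permuteᵛ π u) (permuteᵛ π v))
      ( u≢v ∘ cong proj₁ ∘ permuteᵛ-injective π {u} {v} ∘ vertex-≡
      , to (Overlap-permuteᵛ π {u} {v}) u∩v))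
  (λ πu~πv → let (πu≢πv , πu∩πv) = to (Adj⇔≢×Overlap (permuteᵛ π u) (permuteᵛ π v)) πu~πv in
    from (Adj⇔≢×Overlap u v) (πu≢πv ∘ cong (permute π) , from (Overlap-permuteᵛ π {u} {v}) πu∩πv))

permuteᵛ-Aut : ∀ {n} → Permutation′ n → Aut n
permuteᵛ-Aut π = record
  { f         = permuteᵛ π
  ; bijective = permuteᵛ-injective π
              , λ v → permuteᵛ (flip π) v , λ { refl → permuteᵛ-flip (flip π) v }
  ; preserves = Adj-permuteᵛ π
  }

module Automorphism {n} (σ : Aut n) where
  open Aut σ

  f⁻¹ : Vertex n → Vertex n
  f⁻¹ y = proj₁ (proj₂ bijective y)

  f∘f⁻¹ : ∀ y → f (f⁻¹ y) ≡ y
  f∘f⁻¹ y = proj₂ (proj₂ bijective y) refl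

  f⁻¹∘f : ∀ x → f⁻¹ (f x) ≡ x
  f⁻¹∘f x = proj₁ bijective (f∘f⁻¹ (f x))

  Overlap-preserved : ∀ {u v} → Overlap u v → Overlap (f u) (f v)
  Overlap-preserved {u} {v} =
    from (Overlap⇔≡⊎Adj (f u) (f v)) ∘ Sum.map (cong f) (to (preserves u v)) ∘ to (Overlap⇔≡⊎Adj u v)

  Overlap-reflected : ∀ {u v} → Overlap (f u) (f v) → Overlap u v
  Overlap-reflected {u} {v} =
    from (Overlap⇔≡⊎Adj u v) ∘ Sum.map (proj₁ bijective) (from (preserves u v)) ∘ to (Overlap⇔≡⊎Adj (f u) (f v))

  ⊆-preserved : ∀ {u v} → u ⊆ᵛ v → f u ⊆ᵛ f v
  ⊆-preserved {u} {v} u⊆v = from (⊆ᵛ⇔Overlap-mono (f u) (f v)) λ w fu∩w →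
    subst (Overlap (f v)) (f∘f⁻¹ w)
      (Overlap-preserved (to (⊆ᵛ⇔Overlap-mono u v) u⊆v (f⁻¹ w)
        (Overlap-reflected (subst (Overlap (f u)) (sym (f∘f⁻¹ w)) fu∩w))))

  ⊆-reflected : ∀ {u v} → f u ⊆ᵛ f v → u ⊆ᵛ v
  ⊆-reflected {u} {v} fu⊆fv = from (⊆ᵛ⇔Overlap-mono u v) λ w u∩w →
    Overlap-reflected (to (⊆ᵛ⇔Overlap-mono (f u) (f v)) fu⊆fv (f w) (Overlap-preserved u∩w))

  f⁻¹-⊆-reflected : ∀ {u v} → f⁻¹ u ⊆ᵛ f⁻¹ v → u ⊆ᵛ v
  f⁻¹-⊆-reflected {u} {v} h = subst₂ _⊆ᵛ_ (f∘f⁻¹ u) (f∘f⁻¹ v) (⊆-preserved h)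

  image : Fin n → Fin n
  image i = pick (f ⁅ i ⁆ᵛ)

  preimage : Fin n → Fin n
  preimage j = pick (f⁻¹ ⁅ j ⁆ᵛ)

  f-⁅⁆ : ∀ i → f ⁅ i ⁆ᵛ ≡ ⁅ image i ⁆ᵛ
  f-⁅⁆ i = ⁅⁆-image f f⁻¹ f∘f⁻¹ ⊆-reflected (pick∈ (f ⁅ i ⁆ᵛ))

  f⁻¹-⁅⁆ : ∀ j → f⁻¹ ⁅ j ⁆ᵛ ≡ ⁅ preimage j ⁆ᵛ
  f⁻¹-⁅⁆ j = ⁅⁆-image f⁻¹ f f⁻¹∘f f⁻¹-⊆-reflected (pick∈ (f⁻¹ ⁅ j ⁆ᵛ))

  permutationOf : Permutation′ n
  permutationOf = permutation image preimage
    (λ j → pick-⁅⁆ (trans (cong f (sym (f⁻¹-⁅⁆ j))) (f∘f⁻¹ ⁅ j ⁆ᵛ)))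
    (λ i → pick-⁅⁆ (trans (cong f⁻¹ (sym (f-⁅⁆ i))) (f⁻¹∘f ⁅ i ⁆ᵛ)))

  ∈-f : ∀ v j → j ∈ proj₁ (f v) ⇔ preimage j ∈ proj₁ v
  ∈-f v j = mk⇔
    (λ j∈fv → to ⁅⁆⊆⇔∈ (subst (_⊆ᵛ v) (f⁻¹-⁅⁆ j)
      (⊆-reflected (subst (_⊆ᵛ f v) (sym (f∘f⁻¹ ⁅ j ⁆ᵛ)) (from ⁅⁆⊆⇔∈ j∈fv)))))
    (λ j′∈v → to ⁅⁆⊆⇔∈ (subst (_⊆ᵛ f v) (f∘f⁻¹ ⁅ j ⁆ᵛ)
      (⊆-preserved (subst (_⊆ᵛ v) (sym (f⁻¹-⁅⁆ j)) (from ⁅⁆⊆⇔∈ j′∈v)))))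

  f≡permuteᵛ : ∀ v → f v ≡ permuteᵛ permutationOf v
  f≡permuteᵛ v = vertex-≡ (∈-ext λ j →
    Equiv.trans (∈-f v j) (Equiv.sym (∈-permute permutationOf {proj₁ v} {j})))

Aut↔Permutations : ∀ n → Bijection (AutSetoid n) (Permutations n)
Aut↔Permutations n = record
  { to        = permutationOf
  ; cong      = λ {σ} {τ} σ≈τ i → cong pick (σ≈τ ⁅ i ⁆ᵛ)
  ; bijective = (λ {σ} {τ} → injective σ τ) , λ π → permuteᵛ-Aut π , λ {σ} → permutationOf-≈ σ π
  }
  where
  open Automorphism using (permutationOf; f≡permuteᵛ)

  injective : ∀ σ τ → permutationOf σ ≈ permutationOf τ → ∀ v → Aut.f σ v ≡ Aut.f τ v
  injective σ τ πσ≈πτ v = begin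
    Aut.f σ v
      ≡⟨ f≡permuteᵛ σ v ⟩
    permuteᵛ (permutationOf σ) v
      ≡⟨ vertex-≡ (permute-cong (permutationOf σ) (permutationOf τ) πσ≈πτ (proj₁ v)) ⟩
    permuteᵛ (permutationOf τ) v
      ≡⟨ f≡permuteᵛ τ v ⟨
    Aut.f τ v
      ∎
    where open ≡-Reasoning

  permutationOf-≈ : ∀ σ π → (∀ v → Aut.f σ v ≡ permuteᵛ π v) → permutationOf σ ≈ π
  permutationOf-≈ σ π σ≗π i =
    ∈-permute-⁅⁆ π (subst (λ v → pick (Aut.f σ ⁅ i ⁆ᵛ) ∈ proj₁ v) (σ≗π ⁅ i ⁆ᵛ) (pick∈ _))

mainTheorem6 : (n : ℕ) → Bijection (AutSetoid n) (setoid (Fin (n !)))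
mainTheorem6 n = Bijection.trans (Aut↔Permutations n) (Permutations↔Fin! n)
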